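{- Let $b_1,\dots,b_6\in\mathbb Z$ with $b_j\ge2$ for $j\in\{1,2,5,6\}$, and suppose $$M(b_1,\dots,b_6)=\begin{pmatrix} b_1&0&-1&0&0&0\\0&b_2&-1&0&0&0\\-1&-1&b_3&-1&0&0\\0&0&-1&b_4&-1&-1\\0&0&0&-1&b_5&0\\0&0&0&-1&0&b_6\end{pmatrix}$$ is positive definite and unimodular. Then, up to equivalence, $b_1\le23$, $b_2\le133$, $2\le b_3\le7$, $b_4=1$, $b_5\le13$, $b_6\le97$. In particular, there are finitely many such matrices.
   Context: Two such matrices are equivalent if one is obtained from the other by an automorphism of the underlying {\tt H}-graph (tree with edges $1\!-\!3$, $2\!-\!3$, $3\!-\!4$, $4\!-\!5$, $4\!-\!6$), i.e. by a composition of the swaps $b_1\leftrightarrow b_2$, $b_5\leftrightarrow b_6$, and $(b_1,b_2,b_3,b_4,b_5,b_6)\mapsto(b_5,b_6,b_4,b_3,b_1,b_2)$. Unimodular means determinant $1$. -}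

module Defs where

open import Data.Nat using (ℕ; zero; suc)
open import Data.Integer using (ℤ; +_; -_; _+_; _*_; _≤_; _<_)
open import Data.Fin using (Fin; zero; suc; punchIn)
open import Data.Vec using (Vec; []; _∷_; lookup)
open import Data.Product using (_×_)
open import Relation.Binary.PropositionalEquality using (_≡_)
open import Relation.Nullary using (¬_)
open import Relation.Binary.Construct.Closure.ReflexiveTransitive using (Star)

Matrix : ℕ → Set
Matrix n = Fin n → Fin n → ℤ

sumFin : (n : ℕ) → (Fin n → ℤ) → ℤ
sumFin zero    f = + 0
sumFin (suc n) f = f zero + sumFin n (λ i → f (suc i))

negOnePow : ℕ → ℤ
negOnePow zero    = + 1
negOnePow (suc k) = - negOnePow k

det : (n : ℕ) → Matrix n → ℤ
det zero    A = + 1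
det (suc n) A = go (suc n) (λ j → j)
  where
  minor : Fin (suc n) → Matrix n
  minor j r c = A (suc r) (punchIn j c)
  -- alternating sum Σ_j (-1)^j A 0 j det(minor j)
  go : (m : ℕ) → (Fin m → Fin (suc n)) → ℤ
  go zero    e = + 0
  go (suc m) e = A zero (e zero) * det n (minor (e zero)) + - go m (λ i → e (suc i))

Unimodular : (n : ℕ) → Matrix n → Set
Unimodular n A = det n A ≡ + 1

quadForm : (n : ℕ) → Matrix n → (Fin n → ℤ) → ℤ
quadForm n A x = sumFin n (λ i → sumFin n (λ j → x i * A i j * x j))

PositiveDefinite : (n : ℕ) → Matrix n → Set
PositiveDefinite n A = (x : Fin n → ℤ) → ¬ ((i : Fin n) → x i ≡ + 0) → + 0 < quadForm n A x

record B6 : Set where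
  constructor ⟨_,_,_,_,_,_⟩
  field
    b₁ b₂ b₃ b₄ b₅ b₆ : ℤ
open B6 public

M : B6 → Matrix 6
M ⟨ a₁ , a₂ , a₃ , a₄ , a₅ , a₆ ⟩ i j = lookup (lookup rows i) j
  where
  m1 = - (+ 1)
  z  = + 0
  rows : Vec (Vec ℤ 6) 6
  rows = (a₁ ∷ z  ∷ m1 ∷ z  ∷ z  ∷ z  ∷ [])
       ∷ (z  ∷ a₂ ∷ m1 ∷ z  ∷ z  ∷ z  ∷ [])
       ∷ (m1 ∷ m1 ∷ a₃ ∷ m1 ∷ z  ∷ z  ∷ [])
       ∷ (z  ∷ z  ∷ m1 ∷ a₄ ∷ m1 ∷ m1 ∷ [])
       ∷ (z  ∷ z  ∷ z  ∷ m1 ∷ a₅ ∷ z  ∷ [])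
       ∷ (z  ∷ z  ∷ z  ∷ m1 ∷ z  ∷ a₆ ∷ [])
       ∷ []

-- Generators of the automorphism group of the H-graph, acting on tuples.
data Gen : B6 → B6 → Set where
  swap12 : ∀ a₁ a₂ a₃ a₄ a₅ a₆ →
    Gen ⟨ a₁ , a₂ , a₃ , a₄ , a₅ , a₆ ⟩ ⟨ a₂ , a₁ , a₃ , a₄ , a₅ , a₆ ⟩
  swap56 : ∀ a₁ a₂ a₃ a₄ a₅ a₆ →
    Gen ⟨ a₁ , a₂ , a₃ , a₄ , a₅ , a₆ ⟩ ⟨ a₁ , a₂ , a₃ , a₄ , a₆ , a₅ ⟩
  flip   : ∀ a₁ a₂ a₃ a₄ a₅ a₆ →
    Gen ⟨ a₁ , a₂ , a₃ , a₄ , a₅ , a₆ ⟩ ⟨ a₅ , a₆ , a₄ , a₃ , a₁ , a₂ ⟩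

-- Equivalence: related by a composition of the generators
-- (the generators are involutions, so this is an equivalence relation).
Equivalent : B6 → B6 → Set
Equivalent = Star Gen

Bounds : B6 → Set
Bounds c =
  (b₁ c ≤ + 23) × (b₂ c ≤ + 133) × ((+ 2 ≤ b₃ c) × (b₃ c ≤ + 7)) ×
  (b₄ c ≡ + 1) × (b₅ c ≤ + 13) × (b₆ c ≤ + 97)

-- Write X = b₁b₂b₃ − b₁ − b₂ and Y = b₄b₅b₆ − b₅ − b₆ for the determinants of the two
-- stars of the H-graph.  Expanding along the middle edge gives det M = XY − b₁b₂b₅b₆, so
-- unimodularity reads
--   (b₃ − 1/b₁ − 1/b₂)(b₄ − 1/b₅ − 1/b₆) = 1 + 1/(b₁b₂b₅b₆).
-- Positive definiteness gives b₃, b₄ ≥ 1.  If both are ≥ 2 then X ≥ b₁b₂ and Y ≥ b₅b₆,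
-- which leaves no room for the excess 1; so, flipping the graph if necessary, b₄ = 1, and
-- the leaf swaps give b₁ ≤ b₂ and b₅ ≤ b₆.  The left-hand side is monotone in every bⱼ, so
-- a box of tuples holds no solution once the value at its lower corner exceeds
-- 1 + 1/(b₁b₂b₅b₆ at that corner), or the value at its upper corner is at most 1.  Once
-- b₁, b₃, b₅ are pinned the equation factors as (Δ b₂ − e)(Δ b₆ − e') = N, which bounds
-- b₂ and b₆.  A tree of box splittings, found by a computer search, whose leaves are of
-- these three kinds covers all tuples; it is checked by evaluation.
module Submission where

open import Defs
open import Data.Nat using (ℕ; zero; suc; z≤n; s≤s)
open import Data.Integer
  using (ℤ; +_; -_; _+_; _-_; _*_; _≤_; _<_; _⊔_; _⊓_; 0ℤ; 1ℤ; -1ℤ; +≤+; _≤?_; _<?_; nonNegative)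
  renaming (suc to sucℤ)
open import Data.Integer.Properties
open import Data.Integer.Solver using (module +-*-Solver)
open import Data.Integer.Tactic.RingSolver using (solve-∀)
open import Data.Bool using (Bool; T; _∧_)
open import Data.Bool.Properties using (T-∧)
open import Data.Fin using (Fin; zero; suc; punchIn; #_) renaming (_≟_ to _≟ᶠ_)
open import Data.Vec using (Vec; []; _∷_; lookup)
open import Data.Vec.Functional using (Vector; updateAt)
open import Data.Vec.Functional.Properties using (updateAt-updates; updateAt-minimal)
open import Data.Product using (∃; _×_; _,_; proj₁; proj₂)
open import Data.Sum using (_⊎_; [_,_]′)
open import Data.Empty using (⊥; ⊥-elim)
open import Data.Unit using (⊤; tt)
open import Function using (_∘_)
open import Function.Bundles using (Equivalence)
open import Relation.Nullary using (¬_; Dec; yes; no; contradiction)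
open import Relation.Nullary.Decidable using (isYes; toWitness; _×-dec_; _⊎-dec_)
open import Relation.Binary.PropositionalEquality
  using (_≡_; _≢_; refl; sym; trans; cong; cong₂; subst; subst₂; module ≡-Reasoning)
open import Relation.Binary.Construct.Closure.ReflexiveTransitive using (ε; _◅_; _◅◅_)

private variable
  i j l m n r s u v x y : ℤ
  p q : B6

0≤i*j : 0ℤ ≤ i → 0ℤ ≤ j → 0ℤ ≤ i * j
0≤i*j {+ m} {+ n} _ _ = subst (0ℤ ≤_) (pos-* m n) (+≤+ z≤n)

0≤i+j : 0ℤ ≤ i → 0ℤ ≤ j → 0ℤ ≤ i + j
0≤i+j {+ m} {+ n} _ _ = subst (0ℤ ≤_) (pos-+ m n) (+≤+ z≤n)

2≤⇒0≤ : + 2 ≤ i → 0ℤ ≤ i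
2≤⇒0≤ = ≤-trans (+≤+ z≤n)

0≰-1 : ¬ 0ℤ ≤ -1ℤ
0≰-1 ()

≰⇒≥ : ¬ i ≤ j → j ≤ i
≰⇒≥ = <⇒≤ ∘ ≰⇒>

≤-from-diff : j - i ≡ l → 0ℤ ≤ l → i ≤ j
≤-from-diff j-i≡l 0≤l = 0≤i-j⇒j≤i (subst (0ℤ ≤_) (sym j-i≡l) 0≤l)

*-mono-≤-nonNeg : 0ℤ ≤ i → 0ℤ ≤ l → i ≤ j → l ≤ m → i * l ≤ j * m
*-mono-≤-nonNeg {i} {l} {j} {m} 0≤i 0≤l i≤j l≤m = ≤-trans
  (*-monoʳ-≤-nonNeg l {{nonNegative 0≤l}} i≤j)
  (*-monoˡ-≤-nonNeg j {{nonNegative (≤-trans 0≤i i≤j)}} l≤m)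

*-mono-cross : ∀ {x s x' s' y t y' t'} → 0ℤ ≤ x * s → 0ℤ ≤ y * t →
  x * s ≤ x' * s' → y * t ≤ y' * t' → x * y * (s * t) ≤ x' * y' * (s' * t')
*-mono-cross {x} {s} {x'} {s'} {y} {t} {y'} {t'} 0≤xs 0≤yt xs≤x's' yt≤y't' =
  subst₂ _≤_ (regroup x s y t) (regroup x' s' y' t') (*-mono-≤-nonNeg 0≤xs 0≤yt xs≤x's' yt≤y't')
  where
  regroup : ∀ x s y t → x * s * (y * t) ≡ x * y * (s * t)
  regroup = solve-∀

δ : ∀ {n} → Fin n → Fin n → ℤ
δ zero    zero    = 1ℤ
δ zero    (suc _) = 0ℤ
δ (suc _) zero    = 0ℤ
δ (suc i) (suc j) = δ i j

δ-diag : ∀ {n} (i : Fin n) → δ i i ≡ 1ℤ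
δ-diag zero    = refl
δ-diag (suc i) = δ-diag i

sumFin-cong : ∀ n {f g : Fin n → ℤ} → (∀ i → f i ≡ g i) → sumFin n f ≡ sumFin n g
sumFin-cong zero    f≗g = refl
sumFin-cong (suc n) f≗g = cong₂ _+_ (f≗g zero) (sumFin-cong n (f≗g ∘ suc))

sumFin-zero : ∀ n → sumFin n (λ _ → 0ℤ) ≡ 0ℤ
sumFin-zero zero    = refl
sumFin-zero (suc n) = trans (+-identityˡ _) (sumFin-zero n)

sumFin-δ : ∀ n (i : Fin n) (f : Fin n → ℤ) → sumFin n (λ j → δ i j * f j) ≡ f i
sumFin-δ (suc n) zero    f =
  trans (cong₂ _+_ (*-identityˡ (f zero)) (sumFin-zero n)) (+-identityʳ (f zero))
sumFin-δ (suc n) (suc i) f = trans (+-identityˡ _) (sumFin-δ n i (f ∘ suc))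

quadForm-δ : ∀ n (A : Matrix n) (i : Fin n) → quadForm n A (δ i) ≡ A i i
quadForm-δ n A i = begin
  sumFin n (λ r → sumFin n (λ c → δ i r * A r c * δ i c))
    ≡⟨ sumFin-cong n (λ r → trans (sumFin-cong n (λ c → *-comm (δ i r * A r c) (δ i c)))
                                  (sumFin-δ n i (λ c → δ i r * A r c))) ⟩
  sumFin n (λ r → δ i r * A r i)
    ≡⟨ sumFin-δ n i (λ r → A r i) ⟩
  A i i ∎
  where open ≡-Reasoning

positiveDefinite⇒0<diagonal : ∀ n (A : Matrix n) → PositiveDefinite n A → ∀ i → 0ℤ < A i i
positiveDefinite⇒0<diagonal n A pd i =
  subst (0ℤ <_) (quadForm-δ n A i) (pd (δ i) (λ δᵢ≡0 → 1≢0 (trans (sym (δ-diag i)) (δᵢ≡0 i))))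
  where
  1≢0 : 1ℤ ≢ 0ℤ
  1≢0 ()

-- star k p q p' q' = q q' (k − p/q − p'/q'), so starDet k a b is the determinant of the
-- star with centre weight k and leaf weights a, b.
star : ℤ → ℤ → ℤ → ℤ → ℤ → ℤ
star k p q p' q' = k * q * q' - p * q' - p' * q

starDet : ℤ → ℤ → ℤ → ℤ
starDet k a b = star k 1ℤ a 1ℤ b

module _ where
  open +-*-Solver

  -- symbolicDet is det over polynomials, so ⟦ symbolicDet 6 symbolicM ⟧ computes to
  -- det 6 (M b) and det-M is a ring normalisation.
  symbolicDet : ∀ {v} n → (Fin n → Fin n → Polynomial v) → Polynomial v
  symbolicDet zero    A = con 1ℤ
  symbolicDet {v} (suc n) A = expand (suc n) (λ j → j)
    where
    minor : Fin (suc n) → Fin n → Fin n → Polynomial v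
    minor j r c = A (suc r) (punchIn j c)
    expand : (m : ℕ) → (Fin m → Fin (suc n)) → Polynomial v
    expand zero    e = con 0ℤ
    expand (suc m) e = A zero (e zero) :* symbolicDet n (minor (e zero)) :+ :- expand m (e ∘ suc)

  private
    v₁ v₂ v₃ v₄ v₅ v₆ : Polynomial 6
    v₁ = var (# 0)
    v₂ = var (# 1)
    v₃ = var (# 2)
    v₄ = var (# 3)
    v₅ = var (# 4)
    v₆ = var (# 5)

  symbolicM : Fin 6 → Fin 6 → Polynomial 6
  symbolicM r c = lookup (lookup rows r) c
    where
    o m1 : Polynomial 6
    o  = con 0ℤ
    m1 = con (- 1ℤ)
    rows : Vec (Vec (Polynomial 6) 6) 6
    rows = (v₁ ∷ o  ∷ m1 ∷ o  ∷ o  ∷ o  ∷ [])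
         ∷ (o  ∷ v₂ ∷ m1 ∷ o  ∷ o  ∷ o  ∷ [])
         ∷ (m1 ∷ m1 ∷ v₃ ∷ m1 ∷ o  ∷ o  ∷ [])
         ∷ (o  ∷ o  ∷ m1 ∷ v₄ ∷ m1 ∷ m1 ∷ [])
         ∷ (o  ∷ o  ∷ o  ∷ m1 ∷ v₅ ∷ o  ∷ [])
         ∷ (o  ∷ o  ∷ o  ∷ m1 ∷ o  ∷ v₆ ∷ [])
         ∷ []

  det-M : ∀ b → det 6 (M b) ≡
    starDet (b₃ b) (b₁ b) (b₂ b) * starDet (b₄ b) (b₅ b) (b₆ b) - b₁ b * b₂ b * (b₅ b * b₆ b)
  det-M ⟨ a₁ , a₂ , a₃ , a₄ , a₅ , a₆ ⟩ =
    prove (a₁ ∷ a₂ ∷ a₃ ∷ a₄ ∷ a₅ ∷ a₆ ∷ []) (symbolicDet 6 symbolicM) expanded refl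
    where
    starPoly : Polynomial 6 → Polynomial 6 → Polynomial 6 → Polynomial 6
    starPoly k a b = k :* a :* b :- con 1ℤ :* b :- con 1ℤ :* a
    expanded = starPoly v₃ v₁ v₂ :* starPoly v₄ v₅ v₆ :- v₁ :* v₂ :* (v₅ :* v₆)

starDet-comm : ∀ k a b → starDet k a b ≡ starDet k b a
starDet-comm = expanded
  where
  expanded : ∀ k a b → k * a * b - 1ℤ * b - 1ℤ * a ≡ k * b * a - 1ℤ * a - 1ℤ * b
  expanded = solve-∀

starDet-nonNeg : ∀ {k a b} → 1ℤ ≤ k → + 2 ≤ a → + 2 ≤ b → 0ℤ ≤ starDet k a b
starDet-nonNeg {k} {a} {b} 1≤k 2≤a 2≤b = subst (0ℤ ≤_) (sym (expanded k a b))
  (0≤i+j (0≤i+j (0≤i+j (0≤i*j (i≤j⇒0≤j-i 1≤k) (0≤i*j (2≤⇒0≤ 2≤a) (2≤⇒0≤ 2≤b)))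
                       (0≤i*j (i≤j⇒0≤j-i 2≤a) (i≤j⇒0≤j-i 2≤b)))
                (i≤j⇒0≤j-i 2≤a))
         (i≤j⇒0≤j-i 2≤b))
  where
  expanded : ∀ k a b → k * a * b - 1ℤ * b - 1ℤ * a
           ≡ (k - 1ℤ) * (a * b) + (a - + 2) * (b - + 2) + (a - + 2) + (b - + 2)
  expanded = solve-∀

area≤starDet : ∀ {k a b} → + 2 ≤ k → + 2 ≤ a → + 2 ≤ b → a * b ≤ starDet k a b
area≤starDet {k} {a} {b} 2≤k 2≤a 2≤b = ≤-from-diff (expanded k a b)
  (0≤i+j (0≤i+j (0≤i+j (0≤i*j (i≤j⇒0≤j-i 2≤k) (0≤i*j (2≤⇒0≤ 2≤a) (2≤⇒0≤ 2≤b)))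
                       (0≤i*j (i≤j⇒0≤j-i 2≤a) (i≤j⇒0≤j-i 2≤b)))
                (i≤j⇒0≤j-i 2≤a))
         (i≤j⇒0≤j-i 2≤b))
  where
  expanded : ∀ k a b → (k * a * b - 1ℤ * b - 1ℤ * a) - a * b
           ≡ (k - + 2) * (a * b) + (a - + 2) * (b - + 2) + (a - + 2) + (b - + 2)
  expanded = solve-∀

star-mono : ∀ {k K p q p' q' P Q P' Q'} → k ≤ K → P * q ≤ p * Q → P' * q' ≤ p' * Q' →
  0ℤ ≤ q → 0ℤ ≤ q' → 0ℤ ≤ Q → 0ℤ ≤ Q' →
  star k p q p' q' * (Q * Q') ≤ star K P Q P' Q' * (q * q')
star-mono {k} {K} {p} {q} {p'} {q'} {P} {Q} {P'} {Q'} k≤K Pq≤pQ P'q'≤p'Q' 0≤q 0≤q' 0≤Q 0≤Q' =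
  ≤-from-diff (expanded k K p q p' q' P Q P' Q')
    (0≤i+j (0≤i+j (0≤i*j (i≤j⇒0≤j-i k≤K) (0≤i*j (0≤i*j 0≤q 0≤q') (0≤i*j 0≤Q 0≤Q')))
                  (0≤i*j (0≤i*j 0≤q' 0≤Q') (i≤j⇒0≤j-i Pq≤pQ)))
           (0≤i*j (0≤i*j 0≤q 0≤Q) (i≤j⇒0≤j-i P'q'≤p'Q')))
  where
  expanded : ∀ k K p q p' q' P Q P' Q' →
      (K * Q * Q' - P * Q' - P' * Q) * (q * q') - (k * q * q' - p * q' - p' * q) * (Q * Q')
    ≡ (K - k) * (q * q' * (Q * Q')) + q' * Q' * (p * Q - P * q) + q * Q * (p' * Q' - P' * q')
  expanded = solve-∀

starDet-mono : ∀ {k K a A b B} → k ≤ K → a ≤ A → b ≤ B → 0ℤ ≤ a → 0ℤ ≤ b →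
  starDet k a b * (A * B) ≤ starDet K A B * (a * b)
starDet-mono k≤K a≤A b≤B 0≤a 0≤b =
  star-mono {p = 1ℤ} {p' = 1ℤ} {P = 1ℤ} {P' = 1ℤ} k≤K (1*-mono a≤A) (1*-mono b≤B)
    0≤a 0≤b (≤-trans 0≤a a≤A) (≤-trans 0≤b b≤B)
  where
  1*-mono : i ≤ j → 1ℤ * i ≤ 1ℤ * j
  1*-mono = *-monoˡ-≤-nonNeg 1ℤ

leftStar rightStar leafProduct : B6 → ℤ
leftStar    p = starDet (b₃ p) (b₁ p) (b₂ p)
rightStar   p = starDet (b₄ p) (b₅ p) (b₆ p)
leafProduct p = b₁ p * b₂ p * (b₅ p * b₆ p)

record WeightBounds (p : B6) : Set where
  field
    2≤b₁ : + 2 ≤ b₁ p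
    2≤b₂ : + 2 ≤ b₂ p
    1≤b₃ : 1ℤ ≤ b₃ p
    1≤b₄ : 1ℤ ≤ b₄ p
    2≤b₅ : + 2 ≤ b₅ p
    2≤b₆ : + 2 ≤ b₆ p

record Admissible (p : B6) : Set where
  field
    weightBounds : WeightBounds p
    det≡1 : leftStar p * rightStar p ≡ leafProduct p + 1ℤ
  open WeightBounds weightBounds public

admissible : ∀ p → + 2 ≤ b₁ p → + 2 ≤ b₂ p → + 2 ≤ b₅ p → + 2 ≤ b₆ p →
  PositiveDefinite 6 (M p) → Unimodular 6 (M p) → Admissible p
admissible p 2≤b₁ 2≤b₂ 2≤b₅ 2≤b₆ pd unimodular = record
  { weightBounds = record
    { 2≤b₁ = 2≤b₁ ; 2≤b₂ = 2≤b₂ ; 2≤b₅ = 2≤b₅ ; 2≤b₆ = 2≤b₆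
    ; 1≤b₃ = i<j⇒suc[i]≤j (positiveDefinite⇒0<diagonal 6 (M p) pd (# 2))
    ; 1≤b₄ = i<j⇒suc[i]≤j (positiveDefinite⇒0<diagonal 6 (M p) pd (# 3))
    }
  ; det≡1 = begin
      X * Y           ≡⟨ i≡i-j+j (X * Y) R ⟩
      (X * Y - R) + R ≡⟨ cong (_+ R) (trans (sym (det-M p)) unimodular) ⟩
      1ℤ + R          ≡⟨ +-comm 1ℤ R ⟩
      R + 1ℤ          ∎
  }
  where
  open ≡-Reasoning
  X = leftStar p
  Y = rightStar p
  R = leafProduct p
  i≡i-j+j : ∀ i j → i ≡ i - j + j
  i≡i-j+j = solve-∀

gen-admissible : Gen p q → Admissible p → Admissible q
gen-admissible (swap12 a₁ a₂ a₃ a₄ a₅ a₆) adm = record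
  { weightBounds = record
    { 2≤b₁ = 2≤b₂ ; 2≤b₂ = 2≤b₁ ; 1≤b₃ = 1≤b₃ ; 1≤b₄ = 1≤b₄ ; 2≤b₅ = 2≤b₅ ; 2≤b₆ = 2≤b₆ }
  ; det≡1 = trans (cong (_* starDet a₄ a₅ a₆) (starDet-comm a₃ a₂ a₁))
                  (trans det≡1 (cong (λ t → t * (a₅ * a₆) + 1ℤ) (*-comm a₁ a₂)))
  }
  where open Admissible adm
gen-admissible (swap56 a₁ a₂ a₃ a₄ a₅ a₆) adm = record
  { weightBounds = record
    { 2≤b₁ = 2≤b₁ ; 2≤b₂ = 2≤b₂ ; 1≤b₃ = 1≤b₃ ; 1≤b₄ = 1≤b₄ ; 2≤b₅ = 2≤b₆ ; 2≤b₆ = 2≤b₅ }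
  ; det≡1 = trans (cong (starDet a₃ a₁ a₂ *_) (starDet-comm a₄ a₆ a₅))
                  (trans det≡1 (cong (λ t → a₁ * a₂ * t + 1ℤ) (*-comm a₅ a₆)))
  }
  where open Admissible adm
gen-admissible (flip a₁ a₂ a₃ a₄ a₅ a₆) adm = record
  { weightBounds = record
    { 2≤b₁ = 2≤b₅ ; 2≤b₂ = 2≤b₆ ; 1≤b₃ = 1≤b₄ ; 1≤b₄ = 1≤b₃ ; 2≤b₅ = 2≤b₁ ; 2≤b₆ = 2≤b₂ }
  ; det≡1 = trans (*-comm (starDet a₄ a₅ a₆) (starDet a₃ a₁ a₂))
                  (trans det≡1 (cong (_+ 1ℤ) (*-comm (a₁ * a₂) (a₅ * a₆))))
  }
  where open Admissible adm

≈-admissible : Equivalent p q → Admissible p → Admissible q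
≈-admissible ε        adm = adm
≈-admissible (g ◅ gs) adm = ≈-admissible gs (gen-admissible g adm)

-- Reduction to b₄ = 1, b₁ ≤ b₂, b₅ ≤ b₆

u*v+1<x*y : + 2 ≤ u → + 2 ≤ v → u < x → v ≤ y → u * v + 1ℤ < x * y
u*v+1<x*y {u} {v} {x} {y} 2≤u 2≤v u<x v≤y = begin-strict
  u * v + 1ℤ  <⟨ +-monoʳ-< (u * v) (suc[i]≤j⇒i<j 2≤v) ⟩
  u * v + v   ≡⟨ expanded u v ⟩
  sucℤ u * v  ≤⟨ *-mono-≤-nonNeg (2≤⇒0≤ (≤-trans 2≤u (i≤suc[i] u))) (2≤⇒0≤ 2≤v)
                                 (i<j⇒suc[i]≤j u<x) v≤y ⟩
  x * y       ∎
  where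
  open ≤-Reasoning
  expanded : ∀ u v → u * v + v ≡ (1ℤ + u) * v
  expanded = solve-∀

x*y≢u*v+1 : + 2 ≤ u → + 2 ≤ v → u ≤ x → v ≤ y → x * y ≢ u * v + 1ℤ
x*y≢u*v+1 {u} {v} {x} {y} 2≤u 2≤v u≤x v≤y xy≡uv+1 with u <? x | v <? y
... | yes u<x | _       = <-irrefl (sym xy≡uv+1) (u*v+1<x*y 2≤u 2≤v u<x v≤y)
... | no _    | yes v<y = <-irrefl (sym xy≡uv+1)
  (subst₂ _<_ (cong (_+ 1ℤ) (*-comm v u)) (*-comm y x) (u*v+1<x*y 2≤v 2≤u v<y u≤x))
... | no u≮x  | no v≮y  = i≢suc[i] (begin
  u * v        ≡⟨ cong₂ _*_ (≤-antisym u≤x (≮⇒≥ u≮x)) (≤-antisym v≤y (≮⇒≥ v≮y)) ⟩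
  x * y        ≡⟨ xy≡uv+1 ⟩
  u * v + 1ℤ   ≡⟨ +-comm (u * v) 1ℤ ⟩
  sucℤ (u * v) ∎)
  where open ≡-Reasoning

centres-not-both-≥2 : Admissible p → + 2 ≤ b₃ p → + 2 ≤ b₄ p → ⊥
centres-not-both-≥2 adm 2≤b₃ 2≤b₄ = x*y≢u*v+1
  (area≥2 2≤b₁ 2≤b₂) (area≥2 2≤b₅ 2≤b₆)
  (area≤starDet 2≤b₃ 2≤b₁ 2≤b₂) (area≤starDet 2≤b₄ 2≤b₅ 2≤b₆) det≡1
  where
  open Admissible adm
  area≥2 : + 2 ≤ i → + 2 ≤ j → + 2 ≤ i * j
  area≥2 2≤i 2≤j = ≤-trans (+≤+ (s≤s (s≤s z≤n))) (*-mono-≤-nonNeg (+≤+ z≤n) (+≤+ z≤n) 2≤i 2≤j)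

oriented : Admissible p → ∃ λ q → Equivalent p q × Admissible q × b₄ q ≡ 1ℤ
oriented {p} adm with b₄ p ≤? 1ℤ | b₃ p ≤? 1ℤ
... | yes b₄≤1 | _        = p , ε , adm , ≤-antisym b₄≤1 (Admissible.1≤b₄ adm)
... | no _     | yes b₃≤1 = _ , p≈q , ≈-admissible p≈q adm , ≤-antisym b₃≤1 (Admissible.1≤b₃ adm)
  where p≈q = flip (b₁ p) (b₂ p) (b₃ p) (b₄ p) (b₅ p) (b₆ p) ◅ ε
... | no b₄≰1  | no b₃≰1  = ⊥-elim (centres-not-both-≥2 adm (≰1⇒2≤ b₃≰1) (≰1⇒2≤ b₄≰1))
  where
  ≰1⇒2≤ : ¬ i ≤ 1ℤ → + 2 ≤ i
  ≰1⇒2≤ = i<j⇒suc[i]≤j ∘ ≰⇒>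

sorted : B6 → B6
sorted ⟨ a₁ , a₂ , a₃ , a₄ , a₅ , a₆ ⟩ = ⟨ a₁ ⊓ a₂ , a₁ ⊔ a₂ , a₃ , a₄ , a₅ ⊓ a₆ , a₅ ⊔ a₆ ⟩

≈sorted : ∀ p → Equivalent p (sorted p)
≈sorted ⟨ a₁ , a₂ , a₃ , a₄ , a₅ , a₆ ⟩ = sort₁₂ ◅◅ sort₅₆
  where
  sort₁₂ : Equivalent ⟨ a₁ , a₂ , a₃ , a₄ , a₅ , a₆ ⟩ ⟨ a₁ ⊓ a₂ , a₁ ⊔ a₂ , a₃ , a₄ , a₅ , a₆ ⟩
  sort₁₂ with a₁ ≤? a₂
  ... | yes a₁≤a₂ rewrite i≤j⇒i⊓j≡i a₁≤a₂ | i≤j⇒i⊔j≡j a₁≤a₂ = ε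
  ... | no a₁≰a₂ rewrite i≥j⇒i⊓j≡j (≰⇒≥ a₁≰a₂) | i≥j⇒i⊔j≡i (≰⇒≥ a₁≰a₂) =
    swap12 a₁ a₂ a₃ a₄ a₅ a₆ ◅ ε
  sort₅₆ : Equivalent ⟨ a₁ ⊓ a₂ , a₁ ⊔ a₂ , a₃ , a₄ , a₅ , a₆ ⟩
                      ⟨ a₁ ⊓ a₂ , a₁ ⊔ a₂ , a₃ , a₄ , a₅ ⊓ a₆ , a₅ ⊔ a₆ ⟩
  sort₅₆ with a₅ ≤? a₆
  ... | yes a₅≤a₆ rewrite i≤j⇒i⊓j≡i a₅≤a₆ | i≤j⇒i⊔j≡j a₅≤a₆ = ε
  ... | no a₅≰a₆ rewrite i≥j⇒i⊓j≡j (≰⇒≥ a₅≰a₆) | i≥j⇒i⊔j≡i (≰⇒≥ a₅≰a₆) =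
    swap56 (a₁ ⊓ a₂) (a₁ ⊔ a₂) a₃ a₄ a₅ a₆ ◅ ε

infix 4 _≼_

record _≼_ (q p : B6) : Set where
  field
    ≼₁ : b₁ q ≤ b₁ p
    ≼₂ : b₂ q ≤ b₂ p
    ≼₃ : b₃ q ≤ b₃ p
    ≼₄ : b₄ q ≤ b₄ p
    ≼₅ : b₅ q ≤ b₅ p
    ≼₆ : b₆ q ≤ b₆ p

1≤leafProduct : WeightBounds q → 1ℤ ≤ leafProduct q
1≤leafProduct wq = *-mono-≤-nonNeg (+≤+ z≤n) (+≤+ z≤n)
  (*-mono-≤-nonNeg (+≤+ z≤n) (+≤+ z≤n) (2≤⇒1≤ 2≤b₁) (2≤⇒1≤ 2≤b₂))
  (*-mono-≤-nonNeg (+≤+ z≤n) (+≤+ z≤n) (2≤⇒1≤ 2≤b₅) (2≤⇒1≤ 2≤b₆))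
  where
  open WeightBounds wq
  2≤⇒1≤ : + 2 ≤ i → 1ℤ ≤ i
  2≤⇒1≤ = ≤-trans (+≤+ (s≤s z≤n))

leafProduct-mono : WeightBounds q → q ≼ p → leafProduct q ≤ leafProduct p
leafProduct-mono wq q≼p = *-mono-≤-nonNeg
  (0≤i*j (2≤⇒0≤ 2≤b₁) (2≤⇒0≤ 2≤b₂)) (0≤i*j (2≤⇒0≤ 2≤b₅) (2≤⇒0≤ 2≤b₆))
  (*-mono-≤-nonNeg (2≤⇒0≤ 2≤b₁) (2≤⇒0≤ 2≤b₂) ≼₁ ≼₂)
  (*-mono-≤-nonNeg (2≤⇒0≤ 2≤b₅) (2≤⇒0≤ 2≤b₆) ≼₅ ≼₆)
  where
  open WeightBounds wq
  open _≼_ q≼p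

stars-mono : WeightBounds q → q ≼ p →
  leftStar q * rightStar q * leafProduct p ≤ leftStar p * rightStar p * leafProduct q
stars-mono {q} {p} wq q≼p = *-mono-cross
  {x = leftStar q} {s = b₁ p * b₂ p} {x' = leftStar p} {s' = b₁ q * b₂ q}
  {y = rightStar q} {t = b₅ p * b₆ p} {y' = rightStar p} {t' = b₅ q * b₆ q}
  (0≤i*j (starDet-nonNeg 1≤b₃ 2≤b₁ 2≤b₂) (0≤i*j (≤-trans 0≤b₁ ≼₁) (≤-trans 0≤b₂ ≼₂)))
  (0≤i*j (starDet-nonNeg 1≤b₄ 2≤b₅ 2≤b₆) (0≤i*j (≤-trans 0≤b₅ ≼₅) (≤-trans 0≤b₆ ≼₆)))
  (starDet-mono ≼₃ ≼₁ ≼₂ 0≤b₁ 0≤b₂)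
  (starDet-mono ≼₄ ≼₅ ≼₆ 0≤b₅ 0≤b₆)
  where
  open WeightBounds wq
  open _≼_ q≼p
  0≤b₁ = 2≤⇒0≤ 2≤b₁
  0≤b₂ = 2≤⇒0≤ 2≤b₂
  0≤b₅ = 2≤⇒0≤ 2≤b₅
  0≤b₆ = 2≤⇒0≤ 2≤b₆

-- The nonnegative differences below sum to -1.
1+2/l≰1+1/r : 1ℤ ≤ l → l ≤ r → (l + + 2) * r ≤ (r + 1ℤ) * l → ⊥
1+2/l≰1+1/r {l} {r} 1≤l l≤r gap = 0≰-1 (subst (0ℤ ≤_) (expanded l r)
  (0≤i+j (0≤i+j (0≤i+j (i≤j⇒0≤j-i gap) (i≤j⇒0≤j-i l≤r)) (i≤j⇒0≤j-i l≤r)) (i≤j⇒0≤j-i 1≤l)))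
  where
  expanded : ∀ l r → ((r + 1ℤ) * l - (l + + 2) * r) + (r - l) + (r - l) + (l - 1ℤ) ≡ -1ℤ
  expanded = solve-∀

over-sound : Admissible p → WeightBounds q → q ≼ p →
  leafProduct q + + 2 ≤ leftStar q * rightStar q → ⊥
over-sound {p} {q} adm wq q≼p overshoot =
  1+2/l≰1+1/r (1≤leafProduct wq) (leafProduct-mono wq q≼p) (begin
    (L + + 2) * R                ≤⟨ *-monoʳ-≤-nonNeg R {{nonNegative 0≤R}} overshoot ⟩
    leftStar q * rightStar q * R ≤⟨ stars-mono wq q≼p ⟩
    leftStar p * rightStar p * L ≡⟨ cong (_* L) (Admissible.det≡1 adm) ⟩
    (R + 1ℤ) * L                 ∎)
  where
  open ≤-Reasoning
  L = leafProduct q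
  R = leafProduct p
  0≤R : 0ℤ ≤ R
  0≤R = ≤-trans (+≤+ z≤n) (1≤leafProduct (Admissible.weightBounds adm))

data Upper : Set where
  fin : ℤ → Upper
  ∞   : Upper

infix 4 _≤⁺_ _≤ᵘ_ _≤ᵘ?_

_≤⁺_ : ℤ → Upper → Set
x ≤⁺ fin h = x ≤ h
x ≤⁺ ∞     = ⊤

_≤ᵘ_ : Upper → ℤ → Set
fin h ≤ᵘ x = h ≤ x
∞     ≤ᵘ x = ⊥

_≤ᵘ?_ : ∀ u x → Dec (u ≤ᵘ x)
fin h ≤ᵘ? x = h ≤? x
∞     ≤ᵘ? x = no λ ()

≤⁺-≤ᵘ-trans : ∀ u → x ≤⁺ u → u ≤ᵘ y → x ≤ y
≤⁺-≤ᵘ-trans (fin h) = ≤-trans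

-- num u / den u ≤ 1/x whenever 2 ≤ x ≤⁺ u; clamping by 2 keeps den u positive.
num den : Upper → ℤ
num (fin _) = 1ℤ
num ∞       = 0ℤ
den (fin h) = + 2 ⊔ h
den ∞       = 1ℤ

num*x≤1*den : ∀ u → + 2 ≤ x → x ≤⁺ u → num u * x ≤ 1ℤ * den u
num*x≤1*den {x} (fin h) _ x≤h =
  subst₂ _≤_ (sym (*-identityˡ x)) (sym (*-identityˡ (+ 2 ⊔ h))) (≤-trans x≤h (i≤j⊔i (+ 2) h))
num*x≤1*den ∞ _ _ = +≤+ z≤n

1≤den : ∀ u → 1ℤ ≤ den u
1≤den (fin h) = ≤-trans (+≤+ (s≤s z≤n)) (i≤i⊔j (+ 2) h)
1≤den ∞       = ≤-refl

upperStar : ℤ → Upper → Upper → ℤ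
upperStar k u u' = star k (num u) (den u) (num u') (den u')

-- The nonnegative differences below sum to -1.
1+1/r≰1 : 1ℤ ≤ s → (r + 1ℤ) * s ≤ s * r → ⊥
1+1/r≰1 {s} {r} 1≤s excess = 0≰-1 (subst (0ℤ ≤_) (expanded r s)
  (0≤i+j (i≤j⇒0≤j-i excess) (i≤j⇒0≤j-i 1≤s)))
  where
  expanded : ∀ r s → (s * r - (r + 1ℤ) * s) + (s - 1ℤ) ≡ -1ℤ
  expanded = solve-∀

under-sound : ∀ {K} u₁ u₂ u₅ u₆ → Admissible p → b₃ p ≤ K → b₄ p ≡ 1ℤ →
  b₁ p ≤⁺ u₁ → b₂ p ≤⁺ u₂ → b₅ p ≤⁺ u₅ → b₆ p ≤⁺ u₆ →
  upperStar K u₁ u₂ * upperStar 1ℤ u₅ u₆ ≤ den u₁ * den u₂ * (den u₅ * den u₆) → ⊥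
under-sound {p} {K} u₁ u₂ u₅ u₆ adm b₃≤K b₄≡1 ≤u₁ ≤u₂ ≤u₅ ≤u₆ undershoot = 1+1/r≰1 1≤Q (begin
  (R + 1ℤ) * Q                               ≡⟨ cong (_* Q) (sym det≡1) ⟩
  leftStar p * rightStar p * Q               ≤⟨ stars≤upperStars ⟩
  upperStar K u₁ u₂ * upperStar 1ℤ u₅ u₆ * R ≤⟨ *-monoʳ-≤-nonNeg R {{nonNegative 0≤R}} undershoot ⟩
  Q * R                                      ∎)
  where
  open ≤-Reasoning
  open Admissible adm
  R = leafProduct p
  Q = den u₁ * den u₂ * (den u₅ * den u₆)
  0≤R : 0ℤ ≤ R
  0≤R = ≤-trans (+≤+ z≤n) (1≤leafProduct weightBounds)
  0≤den : ∀ u → 0ℤ ≤ den u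
  0≤den u = ≤-trans (+≤+ z≤n) (1≤den u)
  1≤Q : 1ℤ ≤ Q
  1≤Q = *-mono-≤-nonNeg (+≤+ z≤n) (+≤+ z≤n)
    (*-mono-≤-nonNeg (+≤+ z≤n) (+≤+ z≤n) (1≤den u₁) (1≤den u₂))
    (*-mono-≤-nonNeg (+≤+ z≤n) (+≤+ z≤n) (1≤den u₅) (1≤den u₆))
  stars≤upperStars : leftStar p * rightStar p * Q ≤ upperStar K u₁ u₂ * upperStar 1ℤ u₅ u₆ * R
  stars≤upperStars = *-mono-cross
    {x = leftStar p} {s = den u₁ * den u₂} {x' = upperStar K u₁ u₂} {s' = b₁ p * b₂ p}
    {y = rightStar p} {t = den u₅ * den u₆} {y' = upperStar 1ℤ u₅ u₆} {t' = b₅ p * b₆ p}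
    (0≤i*j (starDet-nonNeg 1≤b₃ 2≤b₁ 2≤b₂) (0≤i*j (0≤den u₁) (0≤den u₂)))
    (0≤i*j (starDet-nonNeg 1≤b₄ 2≤b₅ 2≤b₆) (0≤i*j (0≤den u₅) (0≤den u₆)))
    (star-mono {p = 1ℤ} {p' = 1ℤ} {P = num u₁} {P' = num u₂} b₃≤K
      (num*x≤1*den u₁ 2≤b₁ ≤u₁) (num*x≤1*den u₂ 2≤b₂ ≤u₂)
      (2≤⇒0≤ 2≤b₁) (2≤⇒0≤ 2≤b₂) (0≤den u₁) (0≤den u₂))
    (star-mono {p = 1ℤ} {p' = 1ℤ} {P = num u₅} {P' = num u₆} (≤-reflexive b₄≡1)
      (num*x≤1*den u₅ 2≤b₅ ≤u₅) (num*x≤1*den u₆ 2≤b₆ ≤u₆)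
      (2≤⇒0≤ 2≤b₅) (2≤⇒0≤ 2≤b₆) (0≤den u₅) (0≤den u₆))

-- Pinned b₁, b₃, b₅: the hyperbola in (b₂, b₆)

Δ N : ℤ → ℤ → ℤ → ℤ
Δ a k c = (a * k - 1ℤ) * (c - 1ℤ) - a * c
N a k c = a * a * (c * c) + Δ a k c

f₂ f₆ : ℤ → ℤ → ℤ → ℤ → ℤ
f₂ a k c s = Δ a k c * s - a * (c - 1ℤ)
f₆ a k c t = Δ a k c * t - (a * k - 1ℤ) * c

factorisation : ∀ a k c b d → starDet k a b * starDet 1ℤ c d ≡ a * b * (c * d) + 1ℤ →
  f₂ a k c b * f₆ a k c d ≡ N a k c
factorisation a k c b d eq = begin
  f₂ a k c b * f₆ a k c d
    ≡⟨ expanded a k c b d ⟩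
  N a k c + Δ a k c * (starDet k a b * starDet 1ℤ c d - R+1)
    ≡⟨ cong (λ z → N a k c + Δ a k c * (z - R+1)) eq ⟩
  N a k c + Δ a k c * (R+1 - R+1)
    ≡⟨ cancel (N a k c) (Δ a k c) R+1 ⟩
  N a k c ∎
  where
  open ≡-Reasoning
  R+1 = a * b * (c * d) + 1ℤ
  expanded : ∀ a k c b d →
      (((a * k - 1ℤ) * (c - 1ℤ) - a * c) * b - a * (c - 1ℤ))
    * (((a * k - 1ℤ) * (c - 1ℤ) - a * c) * d - (a * k - 1ℤ) * c)
    ≡ (a * a * (c * c) + ((a * k - 1ℤ) * (c - 1ℤ) - a * c))
    + ((a * k - 1ℤ) * (c - 1ℤ) - a * c)
    * ((k * a * b - 1ℤ * b - 1ℤ * a) * (1ℤ * c * d - 1ℤ * d - 1ℤ * c) - (a * b * (c * d) + 1ℤ))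
  expanded = solve-∀
  cancel : ∀ n δ z → n + δ * (z - z) ≡ n
  cancel = solve-∀

TooLarge : ℤ → ℤ → ℤ → Set
TooLarge u v n = 1ℤ ≤ u × n < u * (v ⊔ 1ℤ)

factor-bound : x * y ≡ n → 1ℤ ≤ n → 1ℤ ≤ u → u ≤ x → v ≤ y → u * (v ⊔ 1ℤ) ≤ n
factor-bound {x} {y} {n} {u} {v} xy≡n 1≤n 1≤u u≤x v≤y =
  subst (u * (v ⊔ 1ℤ) ≤_) xy≡n
    (*-mono-≤-nonNeg 0≤u (≤-trans (+≤+ z≤n) (i≤j⊔i v 1ℤ)) u≤x (⊔-lub v≤y 1≤y))
  where
  0≤u = ≤-trans (+≤+ z≤n) 1≤u
  1≤y : 1ℤ ≤ y
  1≤y with 0ℤ <? y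
  ... | yes 0<y = i<j⇒suc[i]≤j 0<y
  ... | no y≯0  = contradiction (≤-trans 1≤n (subst (_≤ 0ℤ) xy≡n xy≤0)) λ { (+≤+ ()) }
    where
    xy≤0 : x * y ≤ 0ℤ
    xy≤0 = subst (x * y ≤_) (*-zeroʳ x)
      (*-monoˡ-≤-nonNeg x {{nonNegative (≤-trans 0≤u u≤x)}} (≮⇒≥ y≯0))

affine-factor-bound : ∀ {D e e' s t n} m t₀ → (D * s - e) * (D * t - e') ≡ n → 1ℤ ≤ n → 0ℤ ≤ D →
  t₀ ≤ t → TooLarge (D * sucℤ m - e) (D * t₀ - e') n → s ≤ m
affine-factor-bound {D} {e} {e'} {s} m t₀ eq 1≤n 0≤D t₀≤t (1≤u , n<uv) with s ≤? m
... | yes s≤m = s≤m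
... | no s≰m  = contradiction
  (factor-bound eq 1≤n 1≤u (affine-mono e (i<j⇒suc[i]≤j (≰⇒> s≰m))) (affine-mono e' t₀≤t))
  (<⇒≱ n<uv)
  where
  affine-mono : ∀ e → i ≤ j → D * i - e ≤ D * j - e
  affine-mono e i≤j = +-monoˡ-≤ (- e) (*-monoˡ-≤-nonNeg D {{nonNegative 0≤D}} i≤j)

-- Boxes and certificates

record Normal (p : B6) : Set where
  field
    isAdmissible : Admissible p
    b₄≡1 : b₄ p ≡ 1ℤ
    b₁≤b₂ : b₁ p ≤ b₂ p
    b₅≤b₆ : b₅ p ≤ b₆ p
  open Admissible isAdmissible public

record Interval : Set where
  constructor [_,_]
  field
    lower : ℤ
    upper : Upper
open Interval

infix 4 _∈ᴵ_ _∈_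

_∈ᴵ_ : ℤ → Interval → Set
x ∈ᴵ I = lower I ≤ x × x ≤⁺ upper I

below above : ℤ → Interval → Interval
below s I = [ lower I , fin s ]
above s I = [ sucℤ s , upper I ]

Box : Set
Box = Vector Interval 5

-- The searched coordinates; b₄ = 1 is fixed.
pattern x₁ = zero
pattern x₂ = suc zero
pattern x₃ = suc (suc zero)
pattern x₅ = suc (suc (suc zero))
pattern x₆ = suc (suc (suc (suc zero)))

coord : Fin 5 → B6 → ℤ
coord x₁ = b₁
coord x₂ = b₂
coord x₃ = b₃
coord x₅ = b₅
coord x₆ = b₆

_∈_ : B6 → Box → Set
p ∈ B = ∀ i → coord i p ∈ᴵ B i

∈-updateAt : ∀ {B i f} → p ∈ B → coord i p ∈ᴵ f (B i) → p ∈ updateAt B i f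
∈-updateAt {p} {B} {i} p∈B x∈fBi j with j ≟ᶠ i
... | yes refl = subst (coord i p ∈ᴵ_) (sym (updateAt-updates i B)) x∈fBi
... | no j≢i   = subst (coord j p ∈ᴵ_) (sym (updateAt-minimal j i B j≢i)) (p∈B j)

-- The lower bounds are raised by the constraints on normal tuples, so the corner itself
-- satisfies the weight bounds.
lowerCorner : Box → B6
lowerCorner B = ⟨ l₁ , l₁ ⊔ lower (B x₂) , 1ℤ ⊔ lower (B x₃) , 1ℤ , l₅ , l₅ ⊔ lower (B x₆) ⟩
  where
  l₁ = + 2 ⊔ lower (B x₁)
  l₅ = + 2 ⊔ lower (B x₅)

lowerCorner-weightBounds : ∀ B → WeightBounds (lowerCorner B)
lowerCorner-weightBounds B = record
  { 2≤b₁ = i≤i⊔j (+ 2) _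
  ; 2≤b₂ = ≤-trans (i≤i⊔j (+ 2) _) (i≤i⊔j _ _)
  ; 1≤b₃ = i≤i⊔j 1ℤ _
  ; 1≤b₄ = ≤-refl
  ; 2≤b₅ = i≤i⊔j (+ 2) _
  ; 2≤b₆ = ≤-trans (i≤i⊔j (+ 2) _) (i≤i⊔j _ _)
  }

lowerCorner-≼ : ∀ {B} → Normal p → p ∈ B → lowerCorner B ≼ p
lowerCorner-≼ {p} np p∈B = record
  { ≼₁ = ≼₁
  ; ≼₂ = ⊔-lub (≤-trans ≼₁ b₁≤b₂) (proj₁ (p∈B x₂))
  ; ≼₃ = ⊔-lub 1≤b₃ (proj₁ (p∈B x₃))
  ; ≼₄ = 1≤b₄
  ; ≼₅ = ≼₅
  ; ≼₆ = ⊔-lub (≤-trans ≼₅ b₅≤b₆) (proj₁ (p∈B x₆))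
  }
  where
  open Normal np
  ≼₁ = ⊔-lub 2≤b₁ (proj₁ (p∈B x₁))
  ≼₅ = ⊔-lub 2≤b₅ (proj₁ (p∈B x₅))

Over : Box → Set
Over B = leafProduct corner + + 2 ≤ leftStar corner * rightStar corner
  where corner = lowerCorner B

Under : Upper → Box → Set
Under ∞       B = ⊥
Under (fin K) B =
  upperStar K (top x₁) (top x₂) * upperStar 1ℤ (top x₅) (top x₆)
    ≤ den (top x₁) * den (top x₂) * (den (top x₅) * den (top x₆))
  where top = upper ∘ B

FactorAt : (a k c l₂ l₆ : ℤ) → (Fin 5 → Upper) → Set
FactorAt a k c l₂ l₆ top =
  (top x₁ ≤ᵘ a × top x₃ ≤ᵘ k × top x₅ ≤ᵘ c) ×
  (a ≤ + 23 × (+ 2 ≤ k × k ≤ + 7) × c ≤ + 13) ×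
  (0ℤ ≤ Δ a k c × 1ℤ ≤ N a k c) ×
  (top x₂ ≤ᵘ + 133 ⊎ TooLarge (f₂ a k c (+ 134)) (f₆ a k c l₆) (N a k c)) ×
  (top x₆ ≤ᵘ + 97  ⊎ TooLarge (f₆ a k c (+ 98))  (f₂ a k c l₂) (N a k c))

Factor : Box → Set
Factor B = FactorAt (b₁ corner) (b₃ corner) (b₅ corner) (b₂ corner) (b₆ corner) (upper ∘ B)
  where corner = lowerCorner B

over? : ∀ B → Dec (Over B)
over? B = _ ≤? _

under? : ∀ u B → Dec (Under u B)
under? ∞       B = no λ ()
under? (fin K) B = _ ≤? _

factorAt? : ∀ a k c l₂ l₆ top → Dec (FactorAt a k c l₂ l₆ top)
factorAt? a k c l₂ l₆ top =
  ((top x₁ ≤ᵘ? a) ×-dec (top x₃ ≤ᵘ? k) ×-dec (top x₅ ≤ᵘ? c)) ×-dec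
  ((a ≤? + 23) ×-dec ((+ 2 ≤? k) ×-dec (k ≤? + 7)) ×-dec (c ≤? + 13)) ×-dec
  ((0ℤ ≤? Δ a k c) ×-dec (1ℤ ≤? N a k c)) ×-dec
  ((top x₂ ≤ᵘ? + 133) ⊎-dec tooLarge? (f₂ a k c (+ 134)) (f₆ a k c l₆) (N a k c)) ×-dec
  ((top x₆ ≤ᵘ? + 97)  ⊎-dec tooLarge? (f₆ a k c (+ 98))  (f₂ a k c l₂) (N a k c))
  where
  tooLarge? : ∀ s t n → Dec (TooLarge s t n)
  tooLarge? s t n = (1ℤ ≤? s) ×-dec (n <? s * (t ⊔ 1ℤ))

factor? : ∀ B → Dec (Factor B)
factor? B = factorAt? (b₁ corner) (b₃ corner) (b₅ corner) (b₂ corner) (b₆ corner) (upper ∘ B)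
  where corner = lowerCorner B

data Certificate : Set where
  split : Fin 5 → ℤ → Certificate → Certificate → Certificate
  over under factor : Certificate

valid : Box → Certificate → Bool
valid B (split i s t t') = valid (updateAt B i (below s)) t ∧ valid (updateAt B i (above s)) t'
valid B over             = isYes (over? B)
valid B under            = isYes (under? (upper (B x₃)) B)
valid B factor           = isYes (factor? B)

under-leaf-sound : ∀ B → Normal p → p ∈ B → Under (upper (B x₃)) B → ⊥
under-leaf-sound B np p∈B undershoot with upper (B x₃) | proj₂ (p∈B x₃)
... | fin K | b₃≤K = under-sound (upper (B x₁)) (upper (B x₂)) (upper (B x₅)) (upper (B x₆))
  isAdmissible b₃≤K b₄≡1 (proj₂ (p∈B x₁)) (proj₂ (p∈B x₂)) (proj₂ (p∈B x₅)) (proj₂ (p∈B x₆))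
  undershoot
  where open Normal np

pin : ∀ {a₁ a₃ a₄ a₅ a k c b d} → a₁ ≡ a → a₃ ≡ k → a₄ ≡ 1ℤ → a₅ ≡ c →
  starDet a₃ a₁ b * starDet a₄ a₅ d ≡ a₁ * b * (a₅ * d) + 1ℤ →
  starDet k a b * starDet 1ℤ c d ≡ a * b * (c * d) + 1ℤ
pin refl refl refl refl eq = eq

factor-leaf-sound : ∀ B → Normal p → p ∈ B → Factor B → Bounds p
factor-leaf-sound {p} B np p∈B
  ((pin₁ , pin₃ , pin₅) , (a≤23 , (2≤k , k≤7) , c≤13) , (0≤Δ , 1≤N) , b₂-test , b₆-test) =
  subst (_≤ + 23) (sym b₁≡a) a≤23 ,
  [ ≤⁺-≤ᵘ-trans (upper (B x₂)) (proj₂ (p∈B x₂)) ,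
    affine-factor-bound (+ 133) (b₆ corner) hyperbola 1≤N 0≤Δ ≼₆ ]′ b₂-test ,
  (subst (+ 2 ≤_) (sym b₃≡k) 2≤k , subst (_≤ + 7) (sym b₃≡k) k≤7) ,
  b₄≡1 ,
  subst (_≤ + 13) (sym b₅≡c) c≤13 ,
  [ ≤⁺-≤ᵘ-trans (upper (B x₆)) (proj₂ (p∈B x₆)) ,
    affine-factor-bound (+ 97) (b₂ corner) hyperbola′ 1≤N 0≤Δ ≼₂ ]′ b₆-test
  where
  open Normal np
  corner = lowerCorner B
  open _≼_ (lowerCorner-≼ np p∈B)
  pinned : ∀ i → coord i corner ≤ coord i p → upper (B i) ≤ᵘ coord i corner →
    coord i p ≡ coord i corner
  pinned i corner≤p pinᵢ = ≤-antisym (≤⁺-≤ᵘ-trans (upper (B i)) (proj₂ (p∈B i)) pinᵢ) corner≤p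
  b₁≡a = pinned x₁ ≼₁ pin₁
  b₃≡k = pinned x₃ ≼₃ pin₃
  b₅≡c = pinned x₅ ≼₅ pin₅
  a = b₁ corner
  k = b₃ corner
  c = b₅ corner
  hyperbola : f₂ a k c (b₂ p) * f₆ a k c (b₆ p) ≡ N a k c
  hyperbola = factorisation a k c (b₂ p) (b₆ p) (pin b₁≡a b₃≡k b₄≡1 b₅≡c det≡1)
  hyperbola′ : f₆ a k c (b₆ p) * f₂ a k c (b₂ p) ≡ N a k c
  hyperbola′ = trans (*-comm (f₆ a k c (b₆ p)) (f₂ a k c (b₂ p))) hyperbola

valid-sound : ∀ B t → T (valid B t) → Normal p → p ∈ B → Bounds p
valid-sound {p} B (split i s t t') ok np p∈B with coord i p ≤? s
... | yes x≤s = valid-sound (updateAt B i (below s)) t (proj₁ (Equivalence.to T-∧ ok)) np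
  (∈-updateAt {f = below s} p∈B (proj₁ (p∈B i) , x≤s))
... | no x≰s  = valid-sound (updateAt B i (above s)) t' (proj₂ (Equivalence.to T-∧ ok)) np
  (∈-updateAt {f = above s} p∈B (i<j⇒suc[i]≤j (≰⇒> x≰s) , proj₂ (p∈B i)))
valid-sound B over   ok np p∈B = ⊥-elim (over-sound (Normal.isAdmissible np)
  (lowerCorner-weightBounds B) (lowerCorner-≼ np p∈B) (toWitness ok))
valid-sound B under  ok np p∈B = ⊥-elim (under-leaf-sound B np p∈B (toWitness ok))
valid-sound B factor ok np p∈B = factor-leaf-sound B np p∈B (toWitness ok)

initialBox : Box
initialBox x₁ = [ + 2 , ∞ ]
initialBox x₂ = [ + 2 , ∞ ]
initialBox x₃ = [ 1ℤ , ∞ ]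
initialBox x₅ = [ + 2 , ∞ ]
initialBox x₆ = [ + 3 , ∞ ]

certificate : Certificate
certificate =
  (split x₃ (+ 1) under
  (split x₃ (+ 2)
    (split x₁ (+ 2)
      (split x₅ (+ 2) under
      (split x₅ (+ 3) under
      (split x₅ (+ 4) factor
      (split x₅ (+ 5) factor
      (split x₅ (+ 6) factor
      (split x₂ (+ 10)
        (split x₂ (+ 2) under
        (split x₅ (+ 14)
          (split x₅ (+ 7) factor
          (split x₅ (+ 8) factor
          (split x₅ (+ 9) factor
          (split x₅ (+ 10) factor
          (split x₅ (+ 11) factor
          (split x₅ (+ 12) factor
          (split x₅ (+ 13) factor (split x₂ (+ 3) (split x₆ (+ 14) under over) over))))))))
          over))
        over))))))
      (split x₅ (+ 8)
        (split x₅ (+ 2) under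
        (split x₅ (+ 3)
          (split x₁ (+ 3) factor
          (split x₁ (+ 4) factor
          (split x₆ (+ 24)
            (split x₆ (+ 3) under
            (split x₆ (+ 4) under
            (split x₆ (+ 5) under
            (split x₆ (+ 6) under
            (split x₁ (+ 22)
              (split x₁ (+ 5) factor
              (split x₁ (+ 6) factor
              (split x₁ (+ 7) factor
              (split x₁ (+ 8) factor
              (split x₁ (+ 9) factor
              (split x₁ (+ 10) factor
              (split x₁ (+ 11) factor
              (split x₁ (+ 12) factor
              (split x₁ (+ 13) factor
              (split x₁ (+ 14) factor
              (split x₁ (+ 15) factor
              (split x₁ (+ 16) factor
              (split x₁ (+ 17) factor
              (split x₁ (+ 18) factor
              (split x₁ (+ 19) factor
              (split x₁ (+ 20) factor (split x₁ (+ 21) factor factor)))))))))))))))))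
              over)))))
            over)))
          (split x₅ (+ 4)
            (split x₁ (+ 3) factor
            (split x₆ (+ 12)
              (split x₆ (+ 4) under
              (split x₁ (+ 11)
                (split x₁ (+ 4) factor
                (split x₁ (+ 5) factor
                (split x₁ (+ 6) factor
                (split x₁ (+ 7) factor
                (split x₁ (+ 8) factor (split x₁ (+ 9) factor (split x₁ (+ 10) factor factor)))))))
                over))
              over))
            (split x₁ (+ 6)
              (split x₁ (+ 3)
                (split x₅ (+ 5) factor (split x₅ (+ 6) factor (split x₅ (+ 7) factor factor)))
                (split x₁ (+ 4) (split x₅ (+ 5) factor (split x₅ (+ 6) factor over))
                (split x₁ (+ 5) (split x₅ (+ 5) factor over) (split x₅ (+ 5) factor over))))
              over))))
        over))
    (split x₅ (+ 4)
      (split x₅ (+ 2)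
        (split x₃ (+ 3)
          (split x₁ (+ 2) factor
          (split x₆ (+ 14)
            (split x₆ (+ 3) under
            (split x₆ (+ 4) under
            (split x₆ (+ 5) under
            (split x₆ (+ 6) under
            (split x₁ (+ 10)
              (split x₁ (+ 3) factor
              (split x₁ (+ 4) factor
              (split x₁ (+ 5) factor
              (split x₁ (+ 6) factor
              (split x₁ (+ 7) factor (split x₁ (+ 8) factor (split x₁ (+ 9) factor factor)))))))
              over)))))
            over))
          (split x₆ (+ 6)
            (split x₃ (+ 7)
              (split x₃ (+ 4)
                (split x₆ (+ 3) under
                (split x₆ (+ 4) under (split x₁ (+ 3) (split x₁ (+ 2) factor factor) over)))
                (split x₃ (+ 5) (split x₆ (+ 3) under (split x₁ (+ 2) factor over))
                (split x₃ (+ 6) (split x₆ (+ 3) under over) (split x₁ (+ 2) factor over))))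
              over)
            over))
        (split x₃ (+ 4)
          (split x₃ (+ 3)
            (split x₅ (+ 3)
              (split x₆ (+ 6)
                (split x₆ (+ 3) under (split x₁ (+ 3) (split x₁ (+ 2) factor factor) over))
                over)
              (split x₁ (+ 2) factor over))
            (split x₁ (+ 2) (split x₅ (+ 3) factor over) over))
          over))
      over)))

certificate-valid : T (valid initialBox certificate)
certificate-valid = tt

starDet-1-2-2 : ∀ {k a b} → k ≡ 1ℤ → a ≡ + 2 → b ≡ + 2 → starDet k a b ≡ 0ℤ
starDet-1-2-2 refl refl refl = refl

3≤b₆ : Normal p → + 3 ≤ b₆ p
3≤b₆ {p} np with b₆ p ≤? + 2
... | no b₆≰2  = i<j⇒suc[i]≤j (≰⇒> b₆≰2)
... | yes b₆≤2 = contradiction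
  (≤-trans (1≤leafProduct weightBounds) (≤-trans (i≤i+j _ 1ℤ) (≤-reflexive R+1≡0)))
  λ { (+≤+ ()) }
  where
  open Normal np
  open ≡-Reasoning
  R+1≡0 : leafProduct p + 1ℤ ≡ 0ℤ
  R+1≡0 = begin
    leafProduct p + 1ℤ       ≡⟨ sym det≡1 ⟩
    leftStar p * rightStar p ≡⟨ cong (leftStar p *_) (starDet-1-2-2 b₄≡1
                                  (≤-antisym (≤-trans b₅≤b₆ b₆≤2) 2≤b₅) (≤-antisym b₆≤2 2≤b₆)) ⟩
    leftStar p * 0ℤ          ≡⟨ *-zeroʳ (leftStar p) ⟩
    0ℤ                       ∎

∈-initialBox : Normal p → p ∈ initialBox
∈-initialBox np x₁ = Normal.2≤b₁ np , tt
∈-initialBox np x₂ = Normal.2≤b₂ np , tt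
∈-initialBox np x₃ = Normal.1≤b₃ np , tt
∈-initialBox np x₅ = Normal.2≤b₅ np , tt
∈-initialBox np x₆ = 3≤b₆ np , tt

bounded : Normal p → Bounds p
bounded np = valid-sound initialBox certificate certificate-valid np (∈-initialBox np)

sorted-normal : Admissible p → b₄ p ≡ 1ℤ → Normal (sorted p)
sorted-normal {p} adm b₄≡1 = record
  { isAdmissible = ≈-admissible (≈sorted p) adm
  ; b₄≡1 = b₄≡1
  ; b₁≤b₂ = i⊓j≤i⊔j (b₁ p) (b₂ p)
  ; b₅≤b₆ = i⊓j≤i⊔j (b₅ p) (b₆ p)
  }

proposition5p1 : (b : B6) →
    + 2 ≤ b₁ b → + 2 ≤ b₂ b → + 2 ≤ b₅ b → + 2 ≤ b₆ b →
    PositiveDefinite 6 (M b) → Unimodular 6 (M b) →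
    ∃ λ c → Equivalent b c × Bounds c
proposition5p1 b 2≤b₁ 2≤b₂ 2≤b₅ 2≤b₆ pd unimodular
  with oriented (admissible b 2≤b₁ 2≤b₂ 2≤b₅ 2≤b₆ pd unimodular)
... | c , b≈c , adm , b₄≡1 = sorted c , b≈c ◅◅ ≈sorted c , bounded (sorted-normal adm b₄≡1)
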